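{- For each $n\in\omega$ let $B_n$ be the $n$-th Bell number, i.e. the number of partitions of an $n$-element set. Then for every $m\geqslant3$, $B_m$ is not a power of $2$. -}

module Defs where

open import Data.Nat using (ℕ; zero; suc; _⊔_)
open import Data.List using (List; []; _∷_; length; concatMap; upTo; map)

-- Set partitions of an n-element set {0,…,n-1} are in canonical bijection with
-- restricted growth strings: sequences a₀ … a_{n-1} with a₀ = 0 and
-- a_{i} ≤ 1 + max(a₀,…,a_{i-1}); element i is placed in block a_i
-- (blocks numbered in order of their least element).
--
-- rgs k n : all restricted-growth continuations of length n when the
-- number of blocks opened so far is k (each next entry is in 0..k; k means
-- "open a new block").
rgs : ℕ → ℕ → List (List ℕ)
rgs k zero    = [] ∷ []
rgs k (suc n) = concatMap (λ a → map (a ∷_) (rgs (next a) n)) (upTo (suc k))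
  where
  next : ℕ → ℕ
  next a = suc a ⊔ k

partitions : ℕ → List (List ℕ)
partitions n = rgs 0 n

Bell : ℕ → ℕ
Bell n = length (partitions n)

{-# OPTIONS --safe #-}
module Submission where

open import Defs
open import Data.Nat using (ℕ; _≤_; _^_)
open import Relation.Binary.PropositionalEquality using (_≡_)
open import Relation.Nullary using (¬_)
open import Data.Product using (∃)

open import Data.Nat.Base using (zero; suc; _+_; _*_; _⊔_; _<_; z≤n; s≤s; NonZero; >-nonZero)
open import Data.Nat.Properties
open import Data.Nat.DivMod using (_%_; _mod_; _/_; m%n<n; m≡m%n+[m/n]*n; [m+kn]%n≡m%n; %-distribˡ-+; %-distribˡ-*; m%n%n≡m%n)
open import Data.Nat.Divisibility using (_∣_; m∣m*n; n∣m⇒m%n≡0)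
open import Data.Nat.ListAction using (sum)
open import Data.Nat.ListAction.Properties using (sum-++)
open import Data.List.Base using (List; []; _∷_; [_]; length; concatMap; map; upTo; _++_)
open import Data.List.Properties using (length-++; length-map; map-++; upTo-∷ʳ)
open import Data.Fin.Base using (Fin; toℕ)
open import Data.Fin.Properties using (toℕ-fromℕ<; fromℕ<-cong; all?)
open import Data.Vec.Base using (Vec; lookup; tabulate; replicate)
open import Data.Vec.Properties using (lookup∘tabulate; lookup-replicate)
open import Data.Product using (_,_)
open import Data.Sum using (_⊎_; inj₁; inj₂)
open import Relation.Nullary.Decidable using (toWitness; ¬?)
open import Relation.Binary.PropositionalEquality using (_≢_; refl; sym; cong; cong₂; subst; module ≡-Reasoning)

-- Let c k n = rgsCount k n count the restricted growth strings of length n that continue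
-- a prefix with k blocks, so that B n = c 0 n and c k (n + 1) = k · c k n + c (k + 1) n.
-- Modulo d the right-hand side only depends on k mod d, hence the vectors (c k n mod d)_{k < d}
-- evolve under a fixed map. For d = 8 they repeat with period 24 and B n mod 8 ≠ 0 throughout
-- one period, so 8 never divides B n. Since B m ≥ 5 for m ≥ 3, the powers 1, 2, 4 are
-- excluded as well.

rgsCount : ℕ → ℕ → ℕ
rgsCount k n = length (rgs k n)

length-concatMap : ∀ {A B : Set} (f : A → List B) (g : A → ℕ) → (∀ x → length (f x) ≡ g x) →
                   ∀ xs → length (concatMap f xs) ≡ sum (map g xs)
length-concatMap f g f≗g []       = refl
length-concatMap f g f≗g (x ∷ xs) = begin
  length (f x ++ concatMap f xs)         ≡⟨ length-++ (f x) ⟩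
  length (f x) + length (concatMap f xs) ≡⟨ cong₂ _+_ (f≗g x) (length-concatMap f g f≗g xs) ⟩
  g x + sum (map g xs)                   ∎
  where open ≡-Reasoning

sum-upTo-suc : ∀ (g : ℕ → ℕ) j → sum (map g (upTo (suc j))) ≡ sum (map g (upTo j)) + g j
sum-upTo-suc g j = begin
  sum (map g (upTo (suc j)))          ≡⟨ cong (λ xs → sum (map g xs)) (sym (upTo-∷ʳ j)) ⟩
  sum (map g (upTo j ++ [ j ]))       ≡⟨ cong sum (map-++ g (upTo j) [ j ]) ⟩
  sum (map g (upTo j) ++ [ g j ])     ≡⟨ sum-++ (map g (upTo j)) [ g j ] ⟩
  sum (map g (upTo j)) + (g j + 0)    ≡⟨ cong (sum (map g (upTo j)) +_) (+-identityʳ (g j)) ⟩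
  sum (map g (upTo j)) + g j          ∎
  where open ≡-Reasoning

sum-upTo-const : ∀ (g : ℕ → ℕ) c j → (∀ a → a < j → g a ≡ c) → sum (map g (upTo j)) ≡ j * c
sum-upTo-const g c zero    g≡c = refl
sum-upTo-const g c (suc j) g≡c = begin
  sum (map g (upTo (suc j)))  ≡⟨ sum-upTo-suc g j ⟩
  sum (map g (upTo j)) + g j  ≡⟨ cong₂ _+_ (sum-upTo-const g c j (λ a a<j → g≡c a (m<n⇒m<1+n a<j))) (g≡c j ≤-refl) ⟩
  j * c + c                   ≡⟨ +-comm (j * c) c ⟩
  suc j * c                   ∎
  where open ≡-Reasoning

-- Of the k + 1 choices for the next entry, the k old blocks leave k blocks open
-- and the new block opens a (k + 1)-th one.
rgsCount-suc : ∀ k n → rgsCount k (suc n) ≡ k * rgsCount k n + rgsCount (suc k) n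
rgsCount-suc k n = begin
  rgsCount k (suc n)                   ≡⟨ length-concatMap extend g (λ a → length-map (a ∷_) (rgs (suc a ⊔ k) n)) (upTo (suc k)) ⟩
  sum (map g (upTo (suc k)))           ≡⟨ sum-upTo-suc g k ⟩
  sum (map g (upTo k)) + g k           ≡⟨ cong₂ _+_ (sum-upTo-const g _ k old-block) new-block ⟩
  k * rgsCount k n + rgsCount (suc k) n ∎
  where
  open ≡-Reasoning

  extend : ℕ → List (List ℕ)
  extend a = map (a ∷_) (rgs (suc a ⊔ k) n)

  g : ℕ → ℕ
  g a = rgsCount (suc a ⊔ k) n

  old-block : ∀ a → a < k → g a ≡ rgsCount k n
  old-block a a<k = cong (λ b → rgsCount b n) (m≤n⇒m⊔n≡n a<k)

  new-block : g k ≡ rgsCount (suc k) n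
  new-block = cong (λ b → rgsCount b n) (m≥n⇒m⊔n≡m (n≤1+n k))

0<rgsCount : ∀ k n → 0 < rgsCount k n
0<rgsCount k zero    = s≤s z≤n
0<rgsCount k (suc n) = subst (0 <_) (sym (rgsCount-suc k n))
  (≤-trans (0<rgsCount (suc k) n) (m≤n+m (rgsCount (suc k) n) (k * rgsCount k n)))

k<rgsCount : ∀ k n → k < rgsCount k (suc n)
k<rgsCount k n = begin-strict
  k                                      ≡⟨ +-identityʳ k ⟨
  k + 0                                  <⟨ +-mono-≤-< k≤k*count (0<rgsCount (suc k) n) ⟩
  k * rgsCount k n + rgsCount (suc k) n  ≡⟨ rgsCount-suc k n ⟨
  rgsCount k (suc n)                     ∎
  where
  open ≤-Reasoning

  k≤k*count : k ≤ k * rgsCount k n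
  k≤k*count = m≤m*n k (rgsCount k n) {{>-nonZero (0<rgsCount k n)}}

5≤Bell : ∀ {m} → 3 ≤ m → 5 ≤ Bell m
5≤Bell {suc (suc (suc n))} (s≤s (s≤s (s≤s _))) = begin
  5                                             ≤⟨ +-mono-≤ (k<rgsCount 1 n) (k<rgsCount 2 n) ⟩
  rgsCount 1 (1 + n) + rgsCount 2 (1 + n)       ≡⟨ cong (_+ rgsCount 2 (1 + n)) (*-identityˡ _) ⟨
  1 * rgsCount 1 (1 + n) + rgsCount 2 (1 + n)   ≡⟨ rgsCount-suc 1 (1 + n) ⟨
  rgsCount 1 (2 + n)                            ≡⟨ rgsCount-suc 0 (2 + n) ⟨
  Bell (3 + n)                                  ∎
  where open ≤-Reasoning

periodic⇒≡% : ∀ {A : Set} (f : ℕ → A) p .{{_ : NonZero p}} → (∀ n → f (n + p) ≡ f n) → ∀ n → f n ≡ f (n % p)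
periodic⇒≡% f p f-periodic n = begin
  f n                    ≡⟨ cong f (m≡m%n+[m/n]*n n p) ⟩
  f (n % p + n / p * p)  ≡⟨ f[r+q*p]≡f[r] (n % p) (n / p) ⟩
  f (n % p)              ∎
  where
  open ≡-Reasoning

  f[r+q*p]≡f[r] : ∀ r q → f (r + q * p) ≡ f r
  f[r+q*p]≡f[r] r zero    = cong f (+-identityʳ r)
  f[r+q*p]≡f[r] r (suc q) = begin
    f (r + (p + q * p))  ≡⟨ cong (λ x → f (r + x)) (+-comm p (q * p)) ⟩
    f (r + (q * p + p))  ≡⟨ cong f (+-assoc r (q * p) p) ⟨
    f (r + q * p + p)    ≡⟨ f-periodic (r + q * p) ⟩
    f (r + q * p)        ≡⟨ f[r+q*p]≡f[r] r q ⟩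
    f r                  ∎

module Residues (d : ℕ) .{{_ : NonZero d}} where

  open ≡-Reasoning

  _‼_ : Vec ℕ d → ℕ → ℕ
  v ‼ k = lookup v (k mod d)

  ‼-cong-% : ∀ (v : Vec ℕ d) {m n} → m % d ≡ n % d → v ‼ m ≡ v ‼ n
  ‼-cong-% v {m} {n} eq = cong (lookup v) (fromℕ<-cong (m % d) (n % d) eq (m%n<n m d) (m%n<n n d))

  suc-% : ∀ k → suc (k % d) % d ≡ suc k % d
  suc-% k = begin
    suc (k % d) % d                   ≡⟨ [m+kn]%n≡m%n (suc (k % d)) (k / d) d ⟨
    suc (k % d + k / d * d) % d       ≡⟨ cong (λ x → suc x % d) (m≡m%n+[m/n]*n k d) ⟨
    suc k % d                         ∎

  %-distrib-*-+ : ∀ a b c → (a * b + c) % d ≡ ((a % d) * (b % d) + c % d) % d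
  %-distrib-*-+ a b c = begin
    (a * b + c) % d                               ≡⟨ %-distribˡ-+ (a * b) c d ⟩
    ((a * b) % d + c % d) % d                     ≡⟨ cong (λ x → (x + c % d) % d) (%-distribˡ-* a b d) ⟩
    (x % d + c % d) % d                           ≡⟨ cong (λ y → (x % d + y) % d) (m%n%n≡m%n c d) ⟨
    (x % d + c % d % d) % d                       ≡⟨ %-distribˡ-+ x (c % d) d ⟨
    (x + c % d) % d                               ∎
    where
    x : ℕ
    x = (a % d) * (b % d)

  step : Vec ℕ d → Vec ℕ d
  step v = tabulate (λ i → (toℕ i * (v ‼ toℕ i) + v ‼ suc (toℕ i)) % d)

  step-‼ : ∀ v k → step v ‼ k ≡ ((k % d) * (v ‼ k) + v ‼ suc k) % d
  step-‼ v k = begin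
    step v ‼ k
      ≡⟨ lookup∘tabulate _ (k mod d) ⟩
    (toℕ (k mod d) * (v ‼ toℕ (k mod d)) + v ‼ suc (toℕ (k mod d))) % d
      ≡⟨ cong (λ i → (i * (v ‼ i) + v ‼ suc i) % d) (toℕ-fromℕ< (m%n<n k d)) ⟩
    ((k % d) * (v ‼ (k % d)) + v ‼ suc (k % d)) % d
      ≡⟨ cong₂ (λ x y → ((k % d) * x + y) % d) (‼-cong-% v (m%n%n≡m%n k d)) (‼-cong-% v (suc-% k)) ⟩
    ((k % d) * (v ‼ k) + v ‼ suc k) % d ∎

  residues : ℕ → Vec ℕ d
  residues zero    = replicate d (1 % d)
  residues (suc n) = step (residues n)

  rgsCount%≡residues‼ : ∀ n k → rgsCount k n % d ≡ residues n ‼ k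
  rgsCount%≡residues‼ zero    k = sym (lookup-replicate (k mod d) (1 % d))
  rgsCount%≡residues‼ (suc n) k = begin
    rgsCount k (suc n) % d
      ≡⟨ cong (_% d) (rgsCount-suc k n) ⟩
    (k * rgsCount k n + rgsCount (suc k) n) % d
      ≡⟨ %-distrib-*-+ k (rgsCount k n) (rgsCount (suc k) n) ⟩
    ((k % d) * (rgsCount k n % d) + rgsCount (suc k) n % d) % d
      ≡⟨ cong₂ (λ x y → ((k % d) * x + y) % d) (rgsCount%≡residues‼ n k) (rgsCount%≡residues‼ n (suc k)) ⟩
    ((k % d) * (residues n ‼ k) + residues n ‼ suc k) % d
      ≡⟨ step-‼ (residues n) k ⟨
    residues (suc n) ‼ k ∎

open Residues 8

residues-period : ∀ n → residues (n + 24) ≡ residues n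
residues-period zero    = refl
residues-period (suc n) = cong step (residues-period n)

Bell%8≢0-on-period : ∀ (r : Fin 24) → residues (toℕ r) ‼ 0 ≢ 0
Bell%8≢0-on-period = toWitness {a? = all? (λ r → ¬? (residues (toℕ r) ‼ 0 ≟ 0))} _

8∤Bell : ∀ m → ¬ 8 ∣ Bell m
8∤Bell m 8∣Bell = Bell%8≢0-on-period (m mod 24) (begin
  residues (toℕ (m mod 24)) ‼ 0  ≡⟨ cong (λ r → residues r ‼ 0) (toℕ-fromℕ< (m%n<n m 24)) ⟩
  residues (m % 24) ‼ 0          ≡⟨ cong (_‼ 0) (periodic⇒≡% residues 24 residues-period m) ⟨
  residues m ‼ 0                 ≡⟨ rgsCount%≡residues‼ m 0 ⟨
  Bell m % 8                     ≡⟨ n∣m⇒m%n≡0 (Bell m) 8 8∣Bell ⟩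
  0                              ∎)
  where open ≡-Reasoning

2^k≤4⊎8∣2^k : ∀ k → 2 ^ k ≤ 4 ⊎ 8 ∣ 2 ^ k
2^k≤4⊎8∣2^k 0                   = inj₁ (s≤s z≤n)
2^k≤4⊎8∣2^k 1                   = inj₁ (s≤s (s≤s z≤n))
2^k≤4⊎8∣2^k 2                   = inj₁ ≤-refl
2^k≤4⊎8∣2^k (suc (suc (suc k))) = inj₂ (subst (8 ∣_) (sym (^-distribˡ-+-* 2 3 k)) (m∣m*n (2 ^ k)))

lemma4p26 : (m : ℕ) → 3 ≤ m → ¬ (∃ λ k → Bell m ≡ 2 ^ k)
lemma4p26 m 3≤m (k , Bell≡2^k) with 2^k≤4⊎8∣2^k k
... | inj₁ 2^k≤4 = n≮n 4 (≤-trans (5≤Bell 3≤m) (subst (_≤ 4) (sym Bell≡2^k) 2^k≤4))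
... | inj₂ 8∣2^k = 8∤Bell m (subst (8 ∣_) (sym Bell≡2^k) 8∣2^k)
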